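{- Let $p\ge 1$ and let $G=K_{p+1}$ be a clique with vertices $v_1,v_2,\ldots,v_p,v_{p+1}$. Let $(L,H)$ be a $(p+1)$-fold correspondence-cover of $K_{p+1}$ with full matchings. Assume there is a collection of $(p+1)!$ distinct proper correspondence-colourings of $K_{p+1}\setminus v_{p+1}$ such that for every $1\le i\le p$, the multiset of restrictions of these colourings to $\{v_i,v_{i+1},\ldots,v_p\}$ consists of $\frac{(p+1)!}{i!}$ distinct colourings, each appearing with multiplicity $i!$. Then these correspondence-colourings can be extended to $(p+1)!$ proper correspondence-colourings of $K_{p+1}$ (each given colouring extended exactly once) such that for every $1\le i\le p+1$, the multiset of restrictions to $\{v_i,v_{i+1},\ldots,v_{p+1}\}$ consists of $\frac{(p+1)!}{(i-1)!}$ distinct colourings, each appearing with multiplicity $(i-1)!$.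
   Context: A correspondence-cover of a graph $G$ is a pair $(L,H)$ where $H$ is a graph and $L:V(G)\to 2^{V(H)}$ satisfies: the sets $L(v)$ partition $V(H)$; each $L(v)$ induces a clique in $H$; if $uv\notin E(G)$ ($u\ne v$) there are no edges of $H$ between $L(u)$ and $L(v)$; if $uv\in E(G)$ the edges between $L(u)$ and $L(v)$ form a matching. It is $q$-fold if $|L(v)|=q$ for all $v$, and a $q$-fold cover has full matchings if for every edge $uv$ of $G$ the matching between $L(u)$ and $L(v)$ is perfect (of size $q$). A (proper) correspondence-colouring of a graph (or of an induced subgraph $G[S]$) is a map $c$ with $c(v)\in L(v)$ for every vertex $v$ such that $\{c(v)\}$ is an independent set of $H$, i.e. $c(u)c(v)\notin E(H)$ for adjacent $u,v$. -}

module Defs where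

open import Data.Nat using (ℕ; zero; suc; _+_; _≤_; _≤?_)
open import Data.Fin using (Fin; toℕ)
open import Data.Fin.Properties using (all?; _≟_)
open import Data.Product using (_×_; _,_; ∃)
open import Data.Bool using (if_then_else_)
open import Data.List using (List; map)
open import Data.Nat.ListAction using (sum)
open import Data.List using () renaming (allFin to allFinL)
open import Relation.Nullary using (¬_; Dec; yes; no; does)
open import Relation.Nullary.Decidable using (_→-dec_)
open import Relation.Binary.PropositionalEquality using (_≡_; _≢_)

Complete : (n : ℕ) → Fin n → Fin n → Set
Complete n u v = u ≢ v

-- V(H) = Fin n × Fin q and L(v) = { (v , a) | a : Fin q }, so the sets L(v)
-- partition V(H) and |L(v)| = q.
record Cover {n : ℕ} (Adj : Fin n → Fin n → Set) (q : ℕ) : Set₁ where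
  field
    E        : Fin n × Fin q → Fin n × Fin q → Set
    E-sym    : ∀ x y → E x y → E y x
    E-irrefl : ∀ x → ¬ E x x
    clique   : ∀ v (a b : Fin q) → a ≢ b → E (v , a) (v , b)
    nonAdj   : ∀ u v → u ≢ v → ¬ Adj u v → ∀ a b → ¬ E (u , a) (v , b)
    -- edges between L(u), L(v) form a matching when uv is an edge of G
    -- (together with E-sym this gives uniqueness on both sides)
    matching : ∀ u v → u ≢ v → Adj u v → ∀ a b b′ →
               E (u , a) (v , b) → E (u , a) (v , b′) → b ≡ b′

-- the cover has full matchings: every matching between L(u), L(v), uv ∈ E(G),
-- is perfect (together with `matching` and E-sym)
FullMatchings : {n : ℕ} {Adj : Fin n → Fin n → Set} {q : ℕ} → Cover Adj q → Set
FullMatchings {n} {Adj} {q} C =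
  ∀ u v → u ≢ v → Adj u v → ∀ (a : Fin q) → ∃ λ (b : Fin q) → Cover.E C (u , a) (v , b)

-- A proper correspondence-colouring of the induced subgraph G[S], where the
-- vertex set S is given by the embedding emb : Fin m → Fin n; c assigns to
-- each vertex s the element (emb s , c s) of L(emb s).
ProperColouring : {n : ℕ} {Adj : Fin n → Fin n → Set} {q : ℕ} → Cover Adj q →
                  {m : ℕ} → (Fin m → Fin n) → (Fin m → Fin q) → Set
ProperColouring {Adj = Adj} C emb c =
  ∀ s t → Adj (emb s) (emb t) → ¬ Cover.E C (emb s , c s) (emb t , c t)

-- Two colourings agree on the vertices whose (0-based) index is ≥ k,
-- i.e. their restrictions to {v_{k+1}, …, v_m} (1-based) coincide.
AgreeFrom : {m q : ℕ} → ℕ → (Fin m → Fin q) → (Fin m → Fin q) → Set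
AgreeFrom k c c′ = ∀ v → k ≤ toℕ v → c v ≡ c′ v

agreeFrom? : {m q : ℕ} (k : ℕ) (c c′ : Fin m → Fin q) → Dec (AgreeFrom k c c′)
agreeFrom? k c c′ = all? (λ v → (k ≤? toℕ v) →-dec (c v ≟ c′ v))

multiplicity : {N m q : ℕ} → ℕ → (Fin N → Fin m → Fin q) → (Fin m → Fin q) → ℕ
multiplicity {N} k F c =
  sum (map (λ j → if does (agreeFrom? k (F j) c) then 1 else 0) (allFinL N))

module Submission where

-- Call the colourings agreeing on the vertices of index ≥ k a class of level k; by hypothesis it has
-- (k+1)! members.  Since the matchings towards the last vertex are perfect, the colour at vertex k is
-- encoded by the colour it forbids at the last vertex, so a class of level k+1 splits into k+2 classes
-- of level k, labelled by distinct forbidden colours.  Going down from the top, give each class of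
-- level k a palette of k+1 colours: the top class gets all p+1 colours, and a class of level k+1 with
-- palette S and set B of labels of its subclasses (|B| = |S| = k+2) hands the subclass labelled b
-- the palette S − ψ(b), where ψ maps B bijectively onto S and fixes B ∩ S.  Then no subclass has its
-- own label in its palette, and each colour of S is missing from exactly one subclass.  A class of
-- level 0 is a single colouring, which gets the unique colour of its palette; by induction on k every
-- colour of the palette of a class of level k is then used exactly k! times in that class.

open import Data.Bool.Base using (if_then_else_)
open import Data.Fin.Base using (Fin; zero; suc; toℕ; inject₁; fromℕ; fromℕ<)
open import Data.Fin.Properties
  using ( _≟_; any?; suc-injective; fromℕ≢inject₁; toℕ-injective; toℕ<n
        ; toℕ-fromℕ<; fromℕ<-toℕ; toℕ-inject₁; toℕ-fromℕ)
open import Data.Fin.Relation.Unary.Top using (view; ‵fromℕ; ‵inject₁; view-inject₁; view-fromℕ)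
open import Data.Fin.Subset using (Subset; _∈_; _∉_; _-_; ⁅_⁆; ⊤)
open import Data.Fin.Subset.Properties using (_∈?_; ∈⊤; p─q⊆p; x∈p∧x≢y⇒x∈p-y)
import Data.List.Base as List
import Data.List.Properties as List
open import Data.Nat.Base using (ℕ; zero; suc; _+_; _*_; _∸_; _!; _<_; _≤_; z≤n; s≤s)
open import Data.Nat.ListAction using () renaming (sum to sumˡ)
import Data.Nat.Properties as ℕ
open import Data.Nat.Properties using (_!≢0; _<?_)
open import Algebra.Properties.Semiring.Sum ℕ.+-*-semiring
  using (sum-syntax; sum-cong-≗; ∑-comm; ∑-distrib-+; *-distribʳ-sum; sum-replicate-zero)
open import Data.Product.Base using (_×_; _,_; ∃; proj₁; proj₂; swap; uncurry)
open import Data.Sum.Base using ([_,_]′; inj₁; inj₂)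
open import Data.Vec.Base using (_∷_; tabulate; there)
open import Data.Vec.Properties using (lookup∘tabulate; tabulate-cong; []=⇒lookup; lookup⇒[]=)
open import Function.Base using (_∘_; id)
open import Function.Bundles using (mk⇔)
open import Level using (Level)
open import Relation.Binary.PropositionalEquality
  using (_≡_; _≢_; refl; sym; trans; cong; cong₂; subst; module ≡-Reasoning)
open import Relation.Binary.Structures using (IsEquivalence)
open import Relation.Nullary using (Dec; yes; no; does; ¬_; contradiction; _×-dec_)
open import Relation.Nullary.Decidable using (does-⇔; dec-true; dec-false)
open import Relation.Unary using (Pred; Decidable; _≐_; _∩_; ∁)
open import Relation.Unary.Properties using (_∩?_; ∁?; U?)

open import Defs

private variable
  a ℓ ℓ′ : Level
  n m : ℕ
  A A′ : Set a
  P : Pred (Fin n) ℓ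
  Q : Pred (Fin n) ℓ′

indicator : Dec A → ℕ
indicator a? = if does a? then 1 else 0

indicator-true : (a? : Dec A) → A → indicator a? ≡ 1
indicator-true a? a rewrite dec-true a? a = refl

indicator-false : (a? : Dec A) → ¬ A → indicator a? ≡ 0
indicator-false a? ¬a rewrite dec-false a? ¬a = refl

indicator-×-dec : (a? : Dec A) (b? : Dec A′) → indicator a? * indicator b? ≡ indicator (a? ×-dec b?)
indicator-×-dec (yes _) (yes _) = refl
indicator-×-dec (yes _) (no _)  = refl
indicator-×-dec (no _)  _       = refl

count : {P : Pred (Fin n) ℓ} → Decidable P → ℕ
count {n = n} P? = ∑[ x < n ] indicator (P? x)

count-cong : (P? : Decidable P) (Q? : Decidable Q) → P ≐ Q → count P? ≡ count Q?
count-cong P? Q? (P⊆Q , Q⊆P) =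
  sum-cong-≗ λ x → cong (λ b → if b then 1 else 0) (does-⇔ (mk⇔ P⊆Q Q⊆P) (P? x) (Q? x))

count-none : {P : Pred (Fin n) ℓ} (P? : Decidable P) → (∀ x → ¬ P x) → count P? ≡ 0
count-none {n = n} P? ∄P =
  trans (sum-cong-≗ λ x → indicator-false (P? x) (∄P x)) (sum-replicate-zero n)

count-all : {P : Pred (Fin n) ℓ} (P? : Decidable P) → (∀ x → P x) → count P? ≡ n
count-all {n = zero}  P? ∀P = refl
count-all {n = suc n} P? ∀P =
  cong₂ _+_ (indicator-true (P? zero) (∀P zero)) (count-all (P? ∘ suc) (∀P ∘ suc))

count-≟ : (x : Fin n) → count (_≟ x) ≡ 1
count-≟ {n = suc n} zero    = cong suc (count-none {n = n} (λ y → suc y ≟ zero) λ _ ())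
count-≟ {n = suc n} (suc x) =
  trans (count-cong (λ y → suc y ≟ suc x) (_≟ x) (suc-injective , cong suc)) (count-≟ x)

count-unique : (P? : Decidable P) → ∀ {x} → P x → (∀ {y} → P y → y ≡ x) → count P? ≡ 1
count-unique P? {x} Px unique = trans (count-cong P? (_≟ x) (unique , λ { refl → Px })) (count-≟ x)

count-split : (P? : Decidable P) (Q? : Decidable Q) → count P? ≡ count (P? ∩? Q?) + count (P? ∩? ∁? Q?)
count-split P? Q? =
  trans (sum-cong-≗ split) (∑-distrib-+ (indicator ∘ (P? ∩? Q?)) (indicator ∘ (P? ∩? ∁? Q?)))
  where
  split : ∀ x → indicator (P? x) ≡ indicator ((P? ∩? Q?) x) + indicator ((P? ∩? ∁? Q?) x)
  split x with P? x | Q? x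
  ... | yes _ | yes _ = refl
  ... | yes _ | no _  = refl
  ... | no _  | _     = refl

count-remove : (P? : Decidable P) → ∀ {x} → P x → count P? ≡ suc (count (P? ∩? ∁? (_≟ x)))
count-remove P? {x} Px = trans (count-split P? (_≟ x))
  (cong (_+ count (P? ∩? ∁? (_≟ x))) (count-unique (P? ∩? (_≟ x)) (Px , refl) proj₂))

count>0⇒∃ : (P? : Decidable P) → 0 < count P? → ∃ P
count>0⇒∃ P? count>0 with any? P?
... | yes ∃P = ∃P
... | no  ∄P = contradiction (count-none P? λ x Px → ∄P (x , Px)) (ℕ.>⇒≢ count>0)

P⇒count>0 : (P? : Decidable P) → ∀ {x} → P x → 0 < count P?
P⇒count>0 P? Px = subst (0 <_) (sym (count-remove P? Px)) ℕ.0<1+n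

count≡1⇒unique : (P? : Decidable P) → count P? ≡ 1 → ∀ {x y} → P x → P y → y ≡ x
count≡1⇒unique P? count≡1 {x} {y} Px Py with y ≟ x
... | yes y≡x = y≡x
... | no  y≢x = contradiction (ℕ.suc-injective (trans (sym (count-remove P? Px)) count≡1))
                              (ℕ.>⇒≢ (P⇒count>0 (P? ∩? ∁? (_≟ x)) (Py , y≢x)))

count-fibres : (P? : Decidable P) (g : Fin n → Fin m) →
               count P? ≡ ∑[ c < m ] count (P? ∩? λ x → g x ≟ c)
count-fibres P? g =
  trans (sum-cong-≗ (sym ∘ fibre-size)) (∑-comm λ x c → indicator (P? x ×-dec g x ≟ c))
  where
  fibre-size : ∀ x → count (λ c → P? x ×-dec g x ≟ c) ≡ indicator (P? x)
  fibre-size x with P? x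
  ... | yes Px = count-unique (λ c → yes Px ×-dec g x ≟ c) (Px , refl) (sym ∘ proj₂)
  ... | no ¬Px = count-none (λ c → no ¬Px ×-dec g x ≟ c) (λ _ → ¬Px ∘ proj₁)

∑-indicator-* : (P? : Decidable P) → ∀ c → ∑[ x < n ] (indicator (P? x) * c) ≡ count P? * c
∑-indicator-* P? c = sym (*-distribʳ-sum c (indicator ∘ P?))

∑-tabulate : (f : Fin n → ℕ) → sumˡ (List.tabulate f) ≡ ∑[ i < n ] f i
∑-tabulate {n = zero}  f = refl
∑-tabulate {n = suc n} f = cong (f zero +_) (∑-tabulate (f ∘ suc))

multiplicity≡count : ∀ {N m q} k (F : Fin N → Fin m → Fin q) c →
                     multiplicity k F c ≡ count (λ j → agreeFrom? k (F j) c)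
multiplicity≡count k F c =
  trans (cong sumˡ (List.map-tabulate id agrees)) (∑-tabulate agrees)
  where
  agrees : Fin _ → ℕ
  agrees j = indicator (agreeFrom? k (F j) c)

rank : {P : Pred (Fin n) ℓ} → Decidable P → Fin n → ℕ
rank P? zero    = 0
rank P? (suc x) = indicator (P? zero) + rank (P? ∘ suc) x

rank<count : (P? : Decidable P) → ∀ {x} → P x → rank P? x < count P?
rank<count P? {zero} Px with P? zero
... | yes _  = ℕ.0<1+n
... | no ¬Px = contradiction Px ¬Px
rank<count P? {suc x} Px = ℕ.+-monoʳ-< (indicator (P? zero)) (rank<count (P? ∘ suc) Px)

rank-injective : (P? : Decidable P) → ∀ {x y} → P x → P y → rank P? x ≡ rank P? y → x ≡ y
rank-injective P? {zero}  {zero}  Px Py r = refl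
rank-injective P? {zero}  {suc y} Px Py r with P? zero
... | yes _  = contradiction (sym r) ℕ.1+n≢0
... | no ¬Px = contradiction Px ¬Px
rank-injective P? {suc x} {zero}  Px Py r with P? zero
... | yes _  = contradiction r ℕ.1+n≢0
... | no ¬Py = contradiction Py ¬Py
rank-injective P? {suc x} {suc y} Px Py r =
  cong suc (rank-injective (P? ∘ suc) Px Py (ℕ.+-cancelˡ-≡ (indicator (P? zero)) _ _ r))

rank-surjective : {P : Pred (Fin n) ℓ} (P? : Decidable P) → ∀ {r} → r < count P? →
                  ∃ λ x → P x × rank P? x ≡ r
rank-surjective {n = suc n} P? {r} r<count with P? zero in eq | r
... | yes P0 | zero  = zero , P0 , refl
... | yes _  | suc r =
  let x , Px , rank≡r = rank-surjective (P? ∘ suc) (ℕ.≤-pred r<count)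
  in suc x , Px , trans (cong (λ d → indicator d + rank (P? ∘ suc) x) eq) (cong suc rank≡r)
... | no _   | r     =
  let x , Px , rank≡r = rank-surjective (P? ∘ suc) r<count
  in suc x , Px , trans (cong (λ d → indicator d + rank (P? ∘ suc) x) eq) rank≡r

module _ {X : Pred (Fin n) ℓ} {Y : Pred (Fin n) ℓ′} (X? : Decidable X) (Y? : Decidable Y) where

  transfer : Fin n → Fin n
  transfer x with any? (λ y → Y? y ×-dec rank Y? y ℕ.≟ rank X? x)
  ... | yes (y , _) = y
  ... | no _        = x

  module _ (count≡ : count X? ≡ count Y?) where

    transfer-∈ : ∀ {x} → X x → Y (transfer x) × rank Y? (transfer x) ≡ rank X? x
    transfer-∈ {x} Xx with any? (λ y → Y? y ×-dec rank Y? y ℕ.≟ rank X? x)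
    ... | yes (_ , Yy , rank≡) = Yy , rank≡
    ... | no ∄y =
      contradiction (rank-surjective Y? (subst (rank X? x <_) count≡ (rank<count X? Xx))) ∄y

    transfer-unique : ∀ {y} → Y y → count (X? ∩? λ x → transfer x ≟ y) ≡ 1
    transfer-unique {y} Yy with rank-surjective X? (subst (rank Y? y <_) (sym count≡) (rank<count Y? Yy))
    ... | x₀ , Xx₀ , rank≡ = count-unique (X? ∩? λ x → transfer x ≟ y) (Xx₀ , hits-y) unique
      where
      open ≡-Reasoning
      hits-y : transfer x₀ ≡ y
      hits-y = rank-injective Y? (proj₁ (transfer-∈ Xx₀)) Yy (trans (proj₂ (transfer-∈ Xx₀)) rank≡)
      unique : ∀ {x} → X x × transfer x ≡ y → x ≡ x₀
      unique {x} (Xx , tx≡y) = rank-injective X? Xx Xx₀ (begin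
        rank X? x             ≡⟨ proj₂ (transfer-∈ Xx) ⟨
        rank Y? (transfer x)  ≡⟨ cong (rank Y?) tx≡y ⟩
        rank Y? y             ≡⟨ rank≡ ⟨
        rank X? x₀            ∎)

module _ {B : Pred (Fin n) ℓ} {S : Pred (Fin n) ℓ′} (B? : Decidable B) (S? : Decidable S) where

  private
    B∖S? : Decidable (B ∩ ∁ S)
    B∖S? = B? ∩? ∁? S?
    S∖B? : Decidable (S ∩ ∁ B)
    S∖B? = S? ∩? ∁? B?

  fixingMatch : Fin n → Fin n
  fixingMatch b with S? b
  ... | yes _ = b
  ... | no _  = transfer B∖S? S∖B? b

  fixingMatch-fixes : ∀ {b} → S b → fixingMatch b ≡ b
  fixingMatch-fixes {b} Sb with S? b
  ... | yes _  = refl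
  ... | no ¬Sb = contradiction Sb ¬Sb

  fixingMatch-transfers : ∀ {b} → ¬ S b → fixingMatch b ≡ transfer B∖S? S∖B? b
  fixingMatch-transfers {b} ¬Sb with S? b
  ... | yes Sb = contradiction Sb ¬Sb
  ... | no _   = refl

  module _ (count≡ : count B? ≡ count S?) where

    private
      count-differences : count B∖S? ≡ count S∖B?
      count-differences = ℕ.+-cancelˡ-≡ (count (B? ∩? S?)) _ _ (begin
        count (B? ∩? S?) + count B∖S?  ≡⟨ count-split B? S? ⟨
        count B?                       ≡⟨ count≡ ⟩
        count S?                       ≡⟨ count-split S? B? ⟩
        count (S? ∩? B?) + count S∖B?  ≡⟨ cong (_+ count S∖B?) (count-cong (S? ∩? B?) (B? ∩? S?)
                                                                           (swap , swap)) ⟩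
        count (B? ∩? S?) + count S∖B?  ∎)
        where open ≡-Reasoning

    fixingMatch-∈ : ∀ {b} → B b → S (fixingMatch b)
    fixingMatch-∈ {b} Bb with S? b
    ... | yes Sb = Sb
    ... | no ¬Sb = proj₁ (proj₁ (transfer-∈ B∖S? S∖B? count-differences (Bb , ¬Sb)))

    fixingMatch-unique : ∀ {s} → S s → count (B? ∩? λ b → fixingMatch b ≟ s) ≡ 1
    fixingMatch-unique {s} Ss with B? s
    ... | yes Bs = count-unique (B? ∩? λ b → fixingMatch b ≟ s) (Bs , fixingMatch-fixes Ss) unique
      where
      unique : ∀ {b} → B b × fixingMatch b ≡ s → b ≡ s
      unique {b} (Bb , fb≡s) with S? b
      ... | yes _  = fb≡s
      ... | no ¬Sb = contradiction (subst B (sym fb≡s) Bs)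
                       (proj₂ (proj₁ (transfer-∈ B∖S? S∖B? count-differences (Bb , ¬Sb))))
    ... | no ¬Bs =
      trans (count-cong (B? ∩? λ b → fixingMatch b ≟ s) (B∖S? ∩? λ b → transfer B∖S? S∖B? b ≟ s)
                        (to , from))
            (transfer-unique B∖S? S∖B? count-differences (Ss , ¬Bs))
      where
      to : ∀ {b} → B b × fixingMatch b ≡ s → (B b × ¬ S b) × transfer B∖S? S∖B? b ≡ s
      to {b} (Bb , fb≡s) with S? b
      ... | yes _  = contradiction (subst B fb≡s Bb) ¬Bs
      ... | no ¬Sb = (Bb , ¬Sb) , fb≡s
      from : ∀ {b} → (B b × ¬ S b) × transfer B∖S? S∖B? b ≡ s → B b × fixingMatch b ≡ s
      from ((Bb , ¬Sb) , tb≡s) = Bb , trans (fixingMatch-transfers ¬Sb) tb≡s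

    fixingMatch-misses : ∀ {s} → S s → suc (count (B? ∩? ∁? λ b → fixingMatch b ≟ s)) ≡ count B?
    fixingMatch-misses {s} Ss = sym (trans (count-split B? λ b → fixingMatch b ≟ s)
      (cong (_+ count (B? ∩? ∁? λ b → fixingMatch b ≟ s)) (fixingMatch-unique Ss)))

subsetOf : {P : Pred (Fin n) ℓ} → Decidable P → Subset n
subsetOf P? = tabulate (does ∘ P?)

∈-subsetOf⁺ : (P? : Decidable P) → ∀ {x} → P x → x ∈ subsetOf P?
∈-subsetOf⁺ P? {x} Px =
  lookup⇒[]= x (subsetOf P?) (trans (lookup∘tabulate (does ∘ P?) x) (dec-true (P? x) Px))

∈-subsetOf⁻ : (P? : Decidable P) → ∀ {x} → x ∈ subsetOf P? → P x
∈-subsetOf⁻ P? {x} x∈ with P? x | trans (sym (lookup∘tabulate (does ∘ P?) x)) ([]=⇒lookup x∈)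
... | yes Px | _  = Px
... | no _   | ()

x∉p-x : ∀ (p : Subset n) x → x ∉ p - x
x∉p-x (_ ∷ p) zero    ()
x∉p-x (_ ∷ p) (suc x) (there x∈) = x∉p-x p x x∈

x∈p-y⇒x≢y : ∀ {p : Subset n} {x y} → x ∈ p - y → x ≢ y
x∈p-y⇒x≢y {p = p} x∈ refl = x∉p-x p _ x∈

count-minus : ∀ {p : Subset n} {x} → x ∈ p → count (_∈? p) ≡ suc (count (_∈? p - x))
count-minus {p = p} {x} x∈p = trans (count-remove (_∈? p) x∈p)
  (cong suc (count-cong ((_∈? p) ∩? ∁? (_≟ x)) (_∈? p - x)
    ( (λ (y∈p , y≢x) → x∈p∧x≢y⇒x∈p-y y∈p y≢x)
    , (λ y∈ → p─q⊆p p ⁅ x ⁆ y∈ , x∈p-y⇒x≢y y∈))))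

-- Agree k j j′: the colourings j and j′ lie in the same class of level k.
-- forbidden k j: the colour at the new vertex that vertex k, coloured as in j, rules out.
module LastColour
  {N p : ℕ}
  (Agree : ℕ → Fin N → Fin N → Set)
  (agree? : ∀ k j → Decidable (Agree k j))
  (agree-isEquivalence : ∀ k → IsEquivalence (Agree k))
  (agree-suc : ∀ {k j j′} → Agree k j j′ → Agree (suc k) j j′)
  (class-size : ∀ {k} → k ≤ p → ∀ j → count (agree? k j) ≡ suc k !)
  (forbidden : ℕ → Fin N → Fin (suc p))
  (forbidden-cong : ∀ {k j j′} → Agree k j j′ → forbidden k j ≡ forbidden k j′)
  (forbidden-separates : ∀ {k j j′} → k < p → Agree (suc k) j j′ →
                         forbidden k j ≡ forbidden k j′ → Agree k j j′)
  where

  private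
    module Agree k = IsEquivalence (agree-isEquivalence k)

  agree-0⇒≡ : ∀ {j j′} → Agree 0 j j′ → j′ ≡ j
  agree-0⇒≡ {j} = count≡1⇒unique (agree? 0 j) (class-size z≤n j) (Agree.refl 0)

  subclass : ∀ {k j j₀} → k < p → Agree (suc k) j j₀ →
             (Agree (suc k) j ∩ λ j′ → forbidden k j′ ≡ forbidden k j₀) ≐ Agree k j₀
  subclass {k} k<p j∼j₀ =
    (λ (j∼j′ , same) →
       forbidden-separates k<p (Agree.trans (suc k) (Agree.sym (suc k) j∼j₀) j∼j′) (sym same)) ,
    (λ j₀∼j′ → Agree.trans (suc k) j∼j₀ (agree-suc j₀∼j′) , sym (forbidden-cong j₀∼j′))

  Forbids : ℕ → Fin N → Fin (suc p) → Set
  Forbids k j c = ∃ λ j′ → Agree (suc k) j j′ × forbidden k j′ ≡ c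

  forbids? : ∀ k j → Decidable (Forbids k j)
  forbids? k j c = any? λ j′ → agree? (suc k) j j′ ×-dec forbidden k j′ ≟ c

  forbiddenSet : ℕ → Fin N → Subset (suc p)
  forbiddenSet k j = subsetOf (forbids? k j)

  forbidden∈forbiddenSet : ∀ k j → forbidden k j ∈ forbiddenSet k j
  forbidden∈forbiddenSet k j = ∈-subsetOf⁺ (forbids? k j) (j , Agree.refl (suc k) , refl)

  forbiddenSet-cong : ∀ {k j j′} → Agree (suc k) j j′ → forbiddenSet k j ≡ forbiddenSet k j′
  forbiddenSet-cong {k} {j} {j′} j∼j′ = tabulate-cong λ c → does-⇔
    (mk⇔ (λ (i , j∼i , same) → i , Agree.trans (suc k) (Agree.sym (suc k) j∼j′) j∼i , same)
         (λ (i , j′∼i , same) → i , Agree.trans (suc k) j∼j′ j′∼i , same))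
    (forbids? k j c) (forbids? k j′ c)

  count-by-subclass : ∀ {k} → k < p → ∀ j {Q : Pred (Fin N) ℓ} (Q? : Decidable Q)
    (w : Fin (suc p) → ℕ) →
    (∀ {j₀} → Agree (suc k) j j₀ → count (agree? k j₀ ∩? Q?) ≡ w (forbidden k j₀)) →
    count (agree? (suc k) j ∩? Q?) ≡ ∑[ c < suc p ] (indicator (c ∈? forbiddenSet k j) * w c)
  count-by-subclass {k = k} k<p j {Q} Q? w subclass-count =
    trans (count-fibres (agree? (suc k) j ∩? Q?) (forbidden k)) (sum-cong-≗ fibre)
    where
    labelled? : ∀ c → Decidable ((Agree (suc k) j ∩ Q) ∩ λ j′ → forbidden k j′ ≡ c)
    labelled? c = (agree? (suc k) j ∩? Q?) ∩? λ j′ → forbidden k j′ ≟ c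
    fibre : ∀ c → count (labelled? c) ≡ indicator (c ∈? forbiddenSet k j) * w c
    fibre c with c ∈? forbiddenSet k j
    ... | no c∉ = count-none (labelled? c) λ j′ ((j∼j′ , _) , same) →
                    c∉ (∈-subsetOf⁺ (forbids? k j) (j′ , j∼j′ , same))
    ... | yes c∈ with ∈-subsetOf⁻ (forbids? k j) c∈
    ...   | j₀ , j∼j₀ , refl = begin
      count (labelled? (forbidden k j₀))  ≡⟨ count-cong (labelled? _) (agree? k j₀ ∩? Q?) (to , from) ⟩
      count (agree? k j₀ ∩? Q?)           ≡⟨ subclass-count j∼j₀ ⟩
      w (forbidden k j₀)                  ≡⟨ ℕ.*-identityˡ _ ⟨
      1 * w (forbidden k j₀)              ∎
      where
      open ≡-Reasoning
      to : ∀ {j′} → (Agree (suc k) j j′ × Q j′) × forbidden k j′ ≡ forbidden k j₀ →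
           Agree k j₀ j′ × Q j′
      to ((j∼j′ , Qj′) , same) = proj₁ (subclass k<p j∼j₀) (j∼j′ , same) , Qj′
      from : ∀ {j′} → Agree k j₀ j′ × Q j′ →
             (Agree (suc k) j j′ × Q j′) × forbidden k j′ ≡ forbidden k j₀
      from (j₀∼j′ , Qj′) =
        let j∼j′ , same = proj₂ (subclass k<p j∼j₀) j₀∼j′ in (j∼j′ , Qj′) , same

  forbiddenSet-size : ∀ {k} → k < p → ∀ j → count (_∈? forbiddenSet k j) ≡ suc (suc k)
  forbiddenSet-size {k} k<p j = ℕ.*-cancelʳ-≡ _ _ (suc k !) {{suc k !≢0}} (begin
    count (_∈? forbiddenSet k j) * suc k !
      ≡⟨ ∑-indicator-* (_∈? forbiddenSet k j) (suc k !) ⟨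
    ∑[ c < suc p ] (indicator (c ∈? forbiddenSet k j) * suc k !)
      ≡⟨ count-by-subclass k<p j U? (λ _ → suc k !) subclass-size ⟨
    count (agree? (suc k) j ∩? U?)
      ≡⟨ count-∩-U (agree? (suc k) j) ⟩
    count (agree? (suc k) j)
      ≡⟨ class-size k<p j ⟩
    suc (suc k) !
      ∎)
    where
    open ≡-Reasoning
    count-∩-U : ∀ {P : Pred (Fin N) ℓ} (P? : Decidable P) → count (P? ∩? U?) ≡ count P?
    count-∩-U P? = count-cong (P? ∩? U?) P? (proj₁ , (_, _))
    subclass-size : ∀ {j₀} → Agree (suc k) j j₀ → count (agree? k j₀ ∩? U?) ≡ suc k !
    subclass-size {j₀} _ = trans (count-∩-U (agree? k j₀)) (class-size (ℕ.<⇒≤ k<p) j₀)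

  shrink : Subset (suc p) → Subset (suc p) → Fin (suc p) → Subset (suc p)
  shrink B S b = S - fixingMatch (_∈? B) (_∈? S) b

  palette′ : ℕ → ℕ → Fin N → Subset (suc p)
  palette′ zero    k j = ⊤
  palette′ (suc d) k j = shrink (forbiddenSet k j) (palette′ d (suc k) j) (forbidden k j)

  palette : ℕ → Fin N → Subset (suc p)
  palette k = palette′ (p ∸ k) k

  childPalette : ℕ → Fin N → Fin (suc p) → Subset (suc p)
  childPalette k j = shrink (forbiddenSet k j) (palette (suc k) j)

  palette-step : ∀ {k} → k < p → ∀ j → palette k j ≡ childPalette k j (forbidden k j)
  palette-step {k} k<p j = cong (λ d → palette′ d k j) (ℕ.+-∸-assoc 1 k<p)

  palette′-cong : ∀ d k {j j′} → Agree k j j′ → palette′ d k j ≡ palette′ d k j′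
  palette′-cong zero    k j∼j′ = refl
  palette′-cong (suc d) k {j} {j′} j∼j′ =
    trans (cong₂ (λ B S → shrink B S (forbidden k j))
                 (forbiddenSet-cong (agree-suc j∼j′)) (palette′-cong d (suc k) (agree-suc j∼j′)))
          (cong (shrink (forbiddenSet k j′) (palette′ d (suc k) j′)) (forbidden-cong j∼j′))

  palette-subclass : ∀ {k j j₀} → k < p → Agree (suc k) j j₀ →
                     palette k j₀ ≡ childPalette k j (forbidden k j₀)
  palette-subclass {k} {j} {j₀} k<p j∼j₀ = begin
    palette k j₀                        ≡⟨ palette-step k<p j₀ ⟩
    childPalette k j₀ (forbidden k j₀)  ≡⟨ cong₂ (λ B S → shrink B S (forbidden k j₀))
                                                 (forbiddenSet-cong j∼j₀)
                                                 (palette′-cong (p ∸ suc k) (suc k) j∼j₀) ⟨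
    childPalette k j (forbidden k j₀)   ∎
    where open ≡-Reasoning

  palette′-size : ∀ d k → d + k ≡ p → ∀ j → count (_∈? palette′ d k j) ≡ suc k
  palette′-size zero    k refl j = count-all (_∈? ⊤) λ _ → ∈⊤
  palette′-size (suc d) k d+k≡p j = ℕ.suc-injective (begin
    suc (count (_∈? shrink B S (forbidden k j)))
      ≡⟨ count-minus (fixingMatch-∈ (_∈? B) (_∈? S) |B|≡|S| (forbidden∈forbiddenSet k j)) ⟨
    count (_∈? S)
      ≡⟨ |S| ⟩
    suc (suc k)
      ∎)
    where
    open ≡-Reasoning
    k<p : k < p
    k<p = subst (suc k ≤_) d+k≡p (s≤s (ℕ.m≤n+m k d))
    B S : Subset (suc p)
    B = forbiddenSet k j
    S = palette′ d (suc k) j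
    |S| : count (_∈? S) ≡ suc (suc k)
    |S| = palette′-size d (suc k) (trans (ℕ.+-suc d k) d+k≡p) j
    |B|≡|S| : count (_∈? B) ≡ count (_∈? S)
    |B|≡|S| = trans (forbiddenSet-size k<p j) (sym |S|)

  palette-size : ∀ {k} → k ≤ p → ∀ j → count (_∈? palette k j) ≡ suc k
  palette-size {k} k≤p = palette′-size (p ∸ k) k (ℕ.m∸n+n≡m k≤p)

  -- If the label b = forbidden k j lies in the parent palette then fixingMatch fixes it, so b is the
  -- removed colour; otherwise b is not even in the parent palette.
  forbidden∉childPalette : ∀ {k} → k < p → ∀ j {c} → c ∈ childPalette k j (forbidden k j) →
                           c ≢ forbidden k j
  forbidden∉childPalette {k} k<p j c∈ c≡b with forbidden k j ∈? palette (suc k) j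
  ... | yes _   = x∈p-y⇒x≢y c∈ c≡b
  ... | no  b∉S = b∉S (subst (_∈ palette (suc k) j) c≡b (p─q⊆p _ _ c∈))

  ChildContains : ℕ → Fin N → Fin (suc p) → Fin (suc p) → Set
  ChildContains k j c b = b ∈ forbiddenSet k j × c ∈ childPalette k j b

  childContains? : ∀ k j c → Decidable (ChildContains k j c)
  childContains? k j c b = b ∈? forbiddenSet k j ×-dec c ∈? childPalette k j b

  count-childContains : ∀ {k} → k < p → ∀ j c →
                        count (childContains? k j c) ≡ indicator (c ∈? palette (suc k) j) * suc k
  count-childContains {k} k<p j c with c ∈? palette (suc k) j
  ... | no c∉S = count-none (childContains? k j c) λ b (_ , c∈) → c∉S (p─q⊆p _ _ c∈)
  ... | yes c∈S = ℕ.suc-injective (begin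
    suc (count (childContains? k j c))
      ≡⟨ cong suc (count-cong (childContains? k j c) (B? ∩? ∁? λ b → ψ b ≟ c) (to , from)) ⟩
    suc (count (B? ∩? ∁? λ b → ψ b ≟ c))
      ≡⟨ fixingMatch-misses B? S? |B|≡|S| c∈S ⟩
    count B?
      ≡⟨ forbiddenSet-size k<p j ⟩
    suc (suc k)
      ≡⟨ cong suc (ℕ.*-identityˡ (suc k)) ⟨
    suc (1 * suc k)
      ∎)
    where
    open ≡-Reasoning
    B? : Decidable (_∈ forbiddenSet k j)
    B? = _∈? forbiddenSet k j
    S? : Decidable (_∈ palette (suc k) j)
    S? = _∈? palette (suc k) j
    ψ : Fin (suc p) → Fin (suc p)
    ψ = fixingMatch B? S?
    |B|≡|S| : count B? ≡ count S?
    |B|≡|S| = trans (forbiddenSet-size k<p j) (sym (palette-size k<p j))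
    to : ∀ {b} → ChildContains k j c b → b ∈ forbiddenSet k j × ψ b ≢ c
    to (b∈B , c∈) = b∈B , λ ψb≡c → x∈p-y⇒x≢y c∈ (sym ψb≡c)
    from : ∀ {b} → b ∈ forbiddenSet k j × ψ b ≢ c → ChildContains k j c b
    from (b∈B , ψb≢c) = b∈B , x∈p∧x≢y⇒x∈p-y c∈S (ψb≢c ∘ sym)

  colour-exists : ∀ j → ∃ (_∈ palette 0 j)
  colour-exists j = count>0⇒∃ (_∈? palette 0 j) (subst (0 <_) (sym (palette-size z≤n j)) ℕ.0<1+n)

  colour : Fin N → Fin (suc p)
  colour j = proj₁ (colour-exists j)

  colour∈palette : ∀ {k} → k ≤ p → ∀ j → colour j ∈ palette k j
  colour∈palette {zero}  _   j = proj₂ (colour-exists j)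
  colour∈palette {suc k} k<p j =
    p─q⊆p _ _ (subst (colour j ∈_) (palette-step k<p j) (colour∈palette (ℕ.<⇒≤ k<p) j))

  colour-avoids : ∀ {k} → k < p → ∀ j → colour j ≢ forbidden k j
  colour-avoids k<p j =
    forbidden∉childPalette k<p j (subst (colour j ∈_) (palette-step k<p j) (colour∈palette (ℕ.<⇒≤ k<p) j))

  colour-count : ∀ {k} → k ≤ p → ∀ j c →
                 count (agree? k j ∩? λ j′ → colour j′ ≟ c) ≡ indicator (c ∈? palette k j) * k !
  colour-count {zero} _ j c with c ∈? palette 0 j
  ... | yes c∈ =
    count-unique (agree? 0 j ∩? λ j′ → colour j′ ≟ c) (Agree.refl 0 , sym c≡colour) (agree-0⇒≡ ∘ proj₁)
    where
    c≡colour : c ≡ colour j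
    c≡colour = count≡1⇒unique (_∈? palette 0 j) (palette-size z≤n j) (colour∈palette z≤n j) c∈
  ... | no c∉ = count-none (agree? 0 j ∩? λ j′ → colour j′ ≟ c) λ j′ (j∼j′ , colour≡c) →
    c∉ (subst (_∈ palette 0 j) (trans (cong colour (sym (agree-0⇒≡ j∼j′))) colour≡c) (colour∈palette z≤n j))
  colour-count {suc k} k<p j c = begin
    count (agree? (suc k) j ∩? λ j′ → colour j′ ≟ c)
      ≡⟨ count-by-subclass k<p j (λ j′ → colour j′ ≟ c) (λ b → indicator (c ∈? childPalette k j b) * k !)
                           subclass-count ⟩
    ∑[ b < suc p ] (indicator (b ∈? forbiddenSet k j) * (indicator (c ∈? childPalette k j b) * k !))
      ≡⟨ sum-cong-≗ (λ b → trans (sym (ℕ.*-assoc (indicator (b ∈? forbiddenSet k j)) _ (k !)))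
                                 (cong (_* k !) (indicator-×-dec (b ∈? forbiddenSet k j) (c ∈? childPalette k j b)))) ⟩
    ∑[ b < suc p ] (indicator (childContains? k j c b) * k !)
      ≡⟨ ∑-indicator-* (childContains? k j c) (k !) ⟩
    count (childContains? k j c) * k !
      ≡⟨ cong (_* k !) (count-childContains k<p j c) ⟩
    indicator (c ∈? palette (suc k) j) * suc k * k !
      ≡⟨ ℕ.*-assoc (indicator (c ∈? palette (suc k) j)) (suc k) (k !) ⟩
    indicator (c ∈? palette (suc k) j) * suc k !
      ∎
    where
    open ≡-Reasoning
    subclass-count : ∀ {j₀} → Agree (suc k) j j₀ →
      count (agree? k j₀ ∩? λ j′ → colour j′ ≟ c)
        ≡ indicator (c ∈? childPalette k j (forbidden k j₀)) * k !
    subclass-count j∼j₀ = trans (colour-count (ℕ.<⇒≤ k<p) _ c)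
                                (cong (λ P → indicator (c ∈? P) * k !) (palette-subclass k<p j∼j₀))

  colour-multiplicity : ∀ {k} → k ≤ p → ∀ j → count (agree? k j ∩? λ j′ → colour j′ ≟ colour j) ≡ k !
  colour-multiplicity {k} k≤p j = begin
    count (agree? k j ∩? λ j′ → colour j′ ≟ colour j)  ≡⟨ colour-count k≤p j (colour j) ⟩
    indicator (colour j ∈? palette k j) * k !          ≡⟨ cong (_* k !) (indicator-true (colour j ∈? palette k j)
                                                                                        (colour∈palette k≤p j)) ⟩
    1 * k !                                            ≡⟨ ℕ.*-identityˡ (k !) ⟩
    k !                                                ∎
    where open ≡-Reasoning

agreeFrom-isEquivalence : ∀ {N m q} k (F : Fin N → Fin m → Fin q) →
                          IsEquivalence (λ j j′ → AgreeFrom k (F j′) (F j))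
agreeFrom-isEquivalence k F = record
  { refl  = λ _ _ → refl
  ; sym   = λ agree v k≤v → sym (agree v k≤v)
  ; trans = λ agree agree′ v k≤v → trans (agree′ v k≤v) (agree v k≤v)
  }

agreeFrom-suc : ∀ {m q k} {c c′ : Fin m → Fin q} → AgreeFrom k c c′ → AgreeFrom (suc k) c c′
agreeFrom-suc agree v k<v = agree v (ℕ.<⇒≤ k<v)

_▷_ : {p : ℕ} → (Fin p → A) → A → Fin (suc p) → A
(c ▷ x) i with view i
... | ‵fromℕ     = x
... | ‵inject₁ v = c v

▷-inject₁ : {p : ℕ} (c : Fin p → A) (x : A) (v : Fin p) → (c ▷ x) (inject₁ v) ≡ c v
▷-inject₁ c x v rewrite view-inject₁ v = refl

▷-fromℕ : {p : ℕ} (c : Fin p → A) (x : A) → (c ▷ x) (fromℕ p) ≡ x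
▷-fromℕ {p = p} c x rewrite view-fromℕ p = refl

agreeFrom-▷⁺ : ∀ {p q k} {c c′ : Fin p → Fin q} {x x′} →
               AgreeFrom k c′ c → x′ ≡ x → AgreeFrom k (c′ ▷ x′) (c ▷ x)
agreeFrom-▷⁺ {k = k} agree x′≡x u k≤u with view u
... | ‵fromℕ     = x′≡x
... | ‵inject₁ v = agree v (subst (k ≤_) (toℕ-inject₁ v) k≤u)

agreeFrom-▷⁻ : ∀ {p q k} {c c′ : Fin p → Fin q} {x x′} → k ≤ p →
               AgreeFrom k (c′ ▷ x′) (c ▷ x) → AgreeFrom k c′ c × x′ ≡ x
agreeFrom-▷⁻ {p} {k = k} {c} {c′} {x} {x′} k≤p agree =
  (λ v k≤v → begin
    c′ v               ≡⟨ ▷-inject₁ c′ x′ v ⟨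
    (c′ ▷ x′) (inject₁ v)  ≡⟨ agree (inject₁ v) (subst (k ≤_) (sym (toℕ-inject₁ v)) k≤v) ⟩
    (c ▷ x) (inject₁ v)    ≡⟨ ▷-inject₁ c x v ⟩
    c v                    ∎) ,
  (begin
    x′                    ≡⟨ ▷-fromℕ c′ x′ ⟨
    (c′ ▷ x′) (fromℕ p)   ≡⟨ agree (fromℕ p) (subst (k ≤_) (sym (toℕ-fromℕ p)) k≤p) ⟩
    (c ▷ x) (fromℕ p)     ≡⟨ ▷-fromℕ c x ⟩
    x                     ∎)
  where open ≡-Reasoning

module _ {p : ℕ} (C : Cover (Complete (suc p)) (suc p)) (full : FullMatchings C) where

  open Cover C

  private
    inject₁≢fromℕ : (v : Fin p) → inject₁ v ≢ fromℕ p
    inject₁≢fromℕ v = fromℕ≢inject₁ ∘ sym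

  partner : Fin p → Fin (suc p) → Fin (suc p)
  partner v a = proj₁ (full (inject₁ v) (fromℕ p) (inject₁≢fromℕ v) (inject₁≢fromℕ v) a)

  partner-E : ∀ v a → E (inject₁ v , a) (fromℕ p , partner v a)
  partner-E v a = proj₂ (full (inject₁ v) (fromℕ p) (inject₁≢fromℕ v) (inject₁≢fromℕ v) a)

  E⇒partner : ∀ {v a b} → E (inject₁ v , a) (fromℕ p , b) → b ≡ partner v a
  E⇒partner {v} {a} {b} e =
    matching (inject₁ v) (fromℕ p) (inject₁≢fromℕ v) (inject₁≢fromℕ v) a b (partner v a) e (partner-E v a)

  partner-injective : ∀ v {a a′} → partner v a ≡ partner v a′ → a ≡ a′
  partner-injective v {a} {a′} same =
    matching (fromℕ p) (inject₁ v) fromℕ≢v fromℕ≢v (partner v a) a a′ (E-sym _ _ (partner-E v a))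
      (subst (λ b → E (fromℕ p , b) (inject₁ v , a′)) (sym same) (E-sym _ _ (partner-E v a′)))
    where
    fromℕ≢v : fromℕ p ≢ inject₁ v
    fromℕ≢v = fromℕ≢inject₁

  proper-▷ : ∀ {c x} → ProperColouring C inject₁ c → (∀ v → x ≢ partner v (c v)) →
             ProperColouring C id (c ▷ x)
  proper-▷ {c} {x} proper avoids s t s≢t with view s | view t
  ... | ‵fromℕ     | ‵fromℕ     = contradiction refl s≢t
  ... | ‵inject₁ v | ‵inject₁ w = proper v w s≢t
  ... | ‵inject₁ v | ‵fromℕ     = avoids v ∘ E⇒partner
  ... | ‵fromℕ     | ‵inject₁ w = avoids w ∘ E⇒partner ∘ E-sym _ _

  -- Levels k ≥ p have no vertex; there forbiddenAt returns the dummy colour zero.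
  forbiddenAt : (Fin p → Fin (suc p)) → ℕ → Fin (suc p)
  forbiddenAt c k with k <? p
  ... | yes k<p = partner (fromℕ< k<p) (c (fromℕ< k<p))
  ... | no _    = zero

  forbiddenAt-toℕ : ∀ c v → forbiddenAt c (toℕ v) ≡ partner v (c v)
  forbiddenAt-toℕ c v with toℕ v <? p
  ... | yes v<p = cong (λ u → partner u (c u)) (fromℕ<-toℕ v v<p)
  ... | no  v≮p = contradiction (toℕ<n v) v≮p

  forbiddenAt-cong : ∀ {k c c′} → AgreeFrom k c′ c → forbiddenAt c k ≡ forbiddenAt c′ k
  forbiddenAt-cong {k} agree with k <? p
  ... | yes k<p =
    cong (partner (fromℕ< k<p)) (sym (agree (fromℕ< k<p) (ℕ.≤-reflexive (sym (toℕ-fromℕ< k<p)))))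
  ... | no _    = refl

  forbiddenAt-separates : ∀ {k c c′} → k < p → AgreeFrom (suc k) c′ c →
                          forbiddenAt c k ≡ forbiddenAt c′ k → AgreeFrom k c′ c
  forbiddenAt-separates {k} {c} {c′} k<p agree same with k <? p
  ... | no  k≮p = contradiction k<p k≮p
  ... | yes k<p′ = λ u k≤u →
    [ agree u , (λ k≡u → subst (λ w → c′ w ≡ c w) (vertex≡ k≡u) at-k) ]′ (ℕ.m≤n⇒m<n∨m≡n k≤u)
    where
    at-k : c′ (fromℕ< k<p′) ≡ c (fromℕ< k<p′)
    at-k = sym (partner-injective (fromℕ< k<p′) same)
    vertex≡ : ∀ {u} → k ≡ toℕ u → fromℕ< k<p′ ≡ u
    vertex≡ k≡u = toℕ-injective (trans (toℕ-fromℕ< k<p′) k≡u)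

lemma5p3 : (p : ℕ) → 1 ≤ p →
    (C : Cover (Complete (suc p)) (suc p)) → FullMatchings C →
    (col : Fin (suc p !) → Fin p → Fin (suc p)) →
    (∀ j → ProperColouring C inject₁ (col j)) →
    (∀ j j′ → j ≢ j′ → ¬ (∀ v → col j v ≡ col j′ v)) →
    (∀ i → 1 ≤ i → i ≤ p → ∀ j → multiplicity (i ∸ 1) col (col j) ≡ i !) →
    ∃ λ (ext : Fin (suc p !) → Fin (suc p) → Fin (suc p)) →
      (∀ j v → ext j (inject₁ v) ≡ col j v) ×
      (∀ j → ProperColouring C id (ext j)) ×
      (∀ i → 1 ≤ i → i ≤ suc p → ∀ j → multiplicity (i ∸ 1) ext (ext j) ≡ (i ∸ 1) !)
lemma5p3 p _ C full col proper _ multiplicity-col =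
  ext , (λ j → ▷-inject₁ (col j) (colour j)) , (λ j → proper-▷ C full (proper j) (avoids j)) , multiplicity-ext
  where
  agree? : ∀ k j → Decidable (λ j′ → AgreeFrom k (col j′) (col j))
  agree? k j j′ = agreeFrom? k (col j′) (col j)

  class-size : ∀ {k} → k ≤ p → ∀ j → count (agree? k j) ≡ suc k !
  class-size {k} k≤p j with ℕ.m≤n⇒m<n∨m≡n k≤p
  ... | inj₁ k<p  =
    trans (sym (multiplicity≡count k col (col j))) (multiplicity-col (suc k) (s≤s z≤n) k<p j)
  ... | inj₂ refl = count-all (agree? k j) λ _ v k≤v → contradiction (toℕ<n v) (ℕ.≤⇒≯ k≤v)

  open LastColour (λ k j j′ → AgreeFrom k (col j′) (col j)) agree? (λ k → agreeFrom-isEquivalence k col)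
                  agreeFrom-suc class-size (λ k j → forbiddenAt C full (col j) k)
                  (forbiddenAt-cong C full) (forbiddenAt-separates C full)

  ext : Fin (suc p !) → Fin (suc p) → Fin (suc p)
  ext j = col j ▷ colour j

  avoids : ∀ j v → colour j ≢ partner C full v (col j v)
  avoids j v = subst (colour j ≢_) (forbiddenAt-toℕ C full (col j) v) (colour-avoids (toℕ<n v) j)

  multiplicity-ext : ∀ i → 1 ≤ i → i ≤ suc p → ∀ j → multiplicity (i ∸ 1) ext (ext j) ≡ (i ∸ 1) !
  multiplicity-ext (suc k) _ (s≤s k≤p) j = begin
    multiplicity k ext (ext j)                         ≡⟨ multiplicity≡count k ext (ext j) ⟩
    count (λ j′ → agreeFrom? k (ext j′) (ext j))       ≡⟨ count-cong (λ j′ → agreeFrom? k (ext j′) (ext j)) sameColour?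
                                                                     (agreeFrom-▷⁻ k≤p , uncurry agreeFrom-▷⁺) ⟩
    count sameColour?                                  ≡⟨ colour-multiplicity k≤p j ⟩
    k !                                                ∎
    where
    open ≡-Reasoning
    sameColour? : Decidable (λ j′ → AgreeFrom k (col j′) (col j) × colour j′ ≡ colour j)
    sameColour? = agree? k j ∩? λ j′ → colour j′ ≟ colour j
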